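{- Let $G$ be a connected graph of order $n\ge 3$ and let $q$ be an integer with $2\le q\le n-1$. Then $ar(G,\mathcal{T}_q)\ge\ell_q(G)+1$.
   Context: A $t$-edge-coloring of $G$ is a surjective map $E(G)\to\{1,\dots,t\}$; a subgraph is rainbow if its edges have pairwise distinct colors. $ar(G,\mathcal{C})$ is the maximum $t$ such that some $t$-edge-coloring of $G$ has no rainbow subgraph isomorphic to a member of $\mathcal{C}$ ($0$ if none). $\mathcal{T}_q$ is the set of trees with exactly $q$ edges. For a graph $H$ with components ordered by decreasing order $|V(H_1)|\ge|V(H_2)|\ge\cdots$, write $or_i(H)=|V(H_i)|$. $\ell_q(G)$ is the maximum number of edges of a disconnected spanning subgraph $H$ of $G$ with $or_1(H)+or_2(H)\le q$. -}

module Defs where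

open import Data.Nat using (ℕ; zero; suc; _+_; _≤_; _∸_)
open import Data.Bool using (Bool; true; false; T)
open import Data.Fin using (Fin; toℕ; inject₁) renaming (suc to fsuc)
open import Data.Fin.Properties using (_≟_)
open import Data.List using (List; length; filter; allFin; cartesianProduct)
open import Data.List.Relation.Unary.All using (All)
open import Data.List.Relation.Unary.Unique.Propositional using (Unique)
open import Data.Product using (Σ; ∃; _×_; _,_; proj₁; proj₂)
open import Relation.Nullary using (¬_)
open import Relation.Nullary.Decidable using (_×-dec_)
open import Relation.Binary.PropositionalEquality using (_≡_)
open import Function.Definitions using (Injective)
import Data.Nat as N
import Data.Bool.Properties as BP

record Graph (n : ℕ) : Set where
  field
    adj   : Fin n → Fin n → Bool
    sym   : ∀ u v → adj u v ≡ adj v u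
    irrefl : ∀ u → adj u u ≡ false
open Graph public

data Reach {n : ℕ} (G : Graph n) : Fin n → Fin n → Set where
  here : ∀ {u} → Reach G u u
  step : ∀ {u w v} → T (adj G u w) → Reach G w v → Reach G u v

Connected : ∀ {n} → Graph n → Set
Connected G = ∀ u v → Reach G u v

edgeCount : ∀ {n} → Graph n → ℕ
edgeCount {n} G =
  length (filter (λ p → (toℕ (proj₁ p) N.<? toℕ (proj₂ p)) ×-dec BP.T? (adj G (proj₁ p) (proj₂ p)))
                 (cartesianProduct (allFin n) (allFin n)))

_⊆G_ : ∀ {n} → Graph n → Graph n → Set
H ⊆G G = ∀ u v → T (adj H u v) → T (adj G u v)

Disconnected : ∀ {n} → Graph n → Set
Disconnected H = Σ _ λ u → Σ _ λ v → ¬ Reach H u v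

-- or₁(H) + or₂(H) ≤ q : for any two distinct components C(u), C(v)
-- (u, v not joined in H), |C(u)| + |C(v)| ≤ q.  Component sizes are bounded
-- via duplicate-free lists of vertices lying in the component.
TwoLargestAtMost : ∀ {n} → Graph n → ℕ → Set
TwoLargestAtMost {n} H q =
  ∀ (u v : Fin n) → ¬ Reach H u v →
  ∀ (A B : List (Fin n)) → Unique A → Unique B →
  All (Reach H u) A → All (Reach H v) B →
  length A + length B ≤ q

LAdmissible : ∀ {n} → Graph n → ℕ → Graph n → Set
LAdmissible G q H = (H ⊆G G) × Disconnected H × TwoLargestAtMost H q

-- A t-edge-coloring of G: a colour for each edge {u,v} (independent of the
-- orientation), surjective onto Fin t.  Values on non-edges are irrelevant.
record EdgeColoring {n : ℕ} (G : Graph n) (t : ℕ) : Set where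
  field
    col  : Fin n → Fin n → Fin t
    symc : ∀ u v → T (adj G u v) → col u v ≡ col v u
    surj : ∀ (k : Fin t) → Σ (Fin n) λ u → Σ (Fin n) λ v → T (adj G u v) × col u v ≡ k
open EdgeColoring public

-- A tree with q edges in G (subgraph of G isomorphic to some member of T_q),
-- given by an injective vertex map f : Fin (q+1) → Fin n together with a
-- parent map: vertex i+1 is attached (as a leaf) to an earlier vertex par i.
record TreeIn {n : ℕ} (G : Graph n) (q : ℕ) : Set where
  field
    f      : Fin (suc q) → Fin n
    f-inj  : Injective _≡_ _≡_ f
    par    : Fin q → Fin (suc q)
    par<   : ∀ i → toℕ (par i) ≤ toℕ i
    isEdge : ∀ i → T (adj G (f (fsuc i)) (f (par i)))
open TreeIn public

Rainbow : ∀ {n t q} {G : Graph n} → EdgeColoring G t → TreeIn G q → Set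
Rainbow c T' = Injective _≡_ _≡_ (λ i → col c (f T' (fsuc i)) (f T' (par T' i)))

NoRainbowTree : ∀ {n t} {G : Graph n} → EdgeColoring G t → ℕ → Set
NoRainbowTree {G = G} c q = ∀ (T' : TreeIn G q) → ¬ Rainbow c T'

-- ar(G, T_q) ≥ m, unfolded from ar being a maximum:
-- some t ≥ m admits a t-edge-coloring of G with no rainbow member of T_q.
arAtLeast : ∀ {n} → Graph n → ℕ → ℕ → Set
arAtLeast G q m = Σ ℕ λ t → m ≤ t × Σ (EdgeColoring G t) λ c → NoRainbowTree c q

-- Give every edge of H its own colour and all other edges of G one further
-- colour; since G is connected and H is not, some edge of G lies outside H,
-- so exactly |E(H)| + 1 colours are used.  A rainbow tree uses at most one edge
-- outside H, so its q + 1 vertices lie in at most two components of H.  Two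
-- distinct components hold at most q vertices, and a single one even fewer,
-- since together with any other component it still holds at most q.
module Submission where

open import Defs
open import Data.Nat using (ℕ; suc; _≤_; _<_; _∸_; _+_; _≤?_; _<?_; s≤s)
open import Data.Nat.Properties using (≤-refl; ≤-trans; <⇒≤; +-comm; +-suc; n≮n; ≮⇒≥; ≤-antisym; <-asym)
open import Data.Bool using (T)
open import Data.Bool.Properties using (T?)
open import Data.Fin using (Fin; toℕ; fromℕ; inject₁) renaming (zero to fzero; suc to fsuc)
open import Data.Fin.Properties using (_≟_; any?; toℕ-injective)
open import Data.Fin.Relation.Unary.Top using (view; ‵fromℕ; ‵inject₁)
open import Data.Maybe using (is-just; to-witness-T)
open import Data.List using (List; []; _∷_; length; map; filter; lookup; allFin; tabulate; cartesianProduct)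
open import Data.List.Properties using (length-map; length-tabulate)
open import Data.List.Relation.Unary.All using (All; []; _∷_)
import Data.List.Relation.Unary.All as All
import Data.List.Relation.Unary.All.Properties as AllP
open import Data.List.Relation.Unary.AllPairs using ([]; _∷_)
open import Data.List.Relation.Unary.Any using (here; index)
open import Data.List.Relation.Unary.Unique.Propositional using (Unique)
import Data.List.Relation.Unary.Unique.Propositional.Properties as UniqueP
open import Data.List.Membership.Propositional using (_∉_)
open import Data.List.Membership.Propositional.Properties using (∈-lookup; ∈-filter⁻)
open import Data.List.Membership.Setoid.Properties using (unique⇒irrelevant)
import Data.List.Membership.DecPropositional as DecMembership
open import Data.Product using (∃; ∃₂; _×_; _,_; proj₂)
open import Data.Product.Properties using (≡-dec)
open import Data.Sum using (_⊎_; inj₁; inj₂; [_,_]; isInj₁)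
import Data.Sum as Sum
open import Data.Empty using (⊥-elim)
open import Data.Unit using (tt)
open import Function using (_∘_; id)
open import Function.Definitions using (Injective)
open import Relation.Nullary using (¬_; Dec; yes; no; contradiction; ¬?)
open import Relation.Nullary.Decidable using (_×-dec_; decidable-stable; toSum; ¬¬-excluded-middle)
open import Relation.Nullary.Negation using (¬¬-map)
open import Relation.Unary using (Decidable)
open import Relation.Unary.Properties using (∁?)
open import Relation.Binary.Definitions using (DecidableEquality)
open import Relation.Binary.PropositionalEquality as ≡ using (_≡_; _≢_; refl; cong; subst)
open import Axiom.UniquenessOfIdentityProofs using (module Decidable⇒UIP)

module _ {n : ℕ} (G : Graph n) where

  adj-sym : ∀ {u v} → T (adj G u v) → T (adj G v u)
  adj-sym {u} {v} = subst T (sym G u v)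

  adj⇒≢ : ∀ {u v} → T (adj G u v) → u ≢ v
  adj⇒≢ {u} e refl = subst T (irrefl G u) e

  reach-snoc : ∀ {u w v} → Reach G u w → T (adj G w v) → Reach G u v
  reach-snoc here       e′ = step e′ here
  reach-snoc (step e r) e′ = step e (reach-snoc r e′)

  reach-trans : ∀ {u w v} → Reach G u w → Reach G w v → Reach G u v
  reach-trans here       r′ = r′
  reach-trans (step e r) r′ = step e (reach-trans r r′)

  reach-sym : ∀ {u v} → Reach G u v → Reach G v u
  reach-sym here       = here
  reach-sym (step e r) = reach-snoc (reach-sym r) (adj-sym e)

crossing-edge : ∀ {n} (G H : Graph n) {a b} → Reach G a b → ¬ Reach H a b →
  ∃₂ λ x y → T (adj G x y) × ¬ T (adj H x y)
crossing-edge G H here a↛b = ⊥-elim (a↛b here)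
crossing-edge G H {a} (step {w = w} e r) a↛b with T? (adj H a w)
... | yes e′ = crossing-edge G H r (a↛b ∘ step e′)
... | no  e∉H = a , w , e , e∉H

unreachable-vertex : ∀ {n} {H : Graph n} → Disconnected H → ∀ u → ¬ ¬ ∃ λ w → ¬ Reach H u w
unreachable-vertex {H = H} (a , b , a↛b) u none =
  none (b , λ u⇝b → none (a , λ u⇝a → a↛b (reach-trans H (reach-sym H u⇝a) u⇝b)))

length-filter+length-filter-∁ : ∀ {A : Set} {P : A → Set} (P? : Decidable P) (xs : List A) →
  length (filter P? xs) + length (filter (∁? P?) xs) ≡ length xs
length-filter+length-filter-∁ P? []       = refl
length-filter+length-filter-∁ P? (x ∷ xs) with P? x
... | yes _ = cong suc (length-filter+length-filter-∁ P? xs)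
... | no  _ = ≡.trans (+-suc _ _) (cong suc (length-filter+length-filter-∁ P? xs))

partition-image : ∀ {A : Set} {P Q : A → Set} {m} (F : Fin m → A) → Injective _≡_ _≡_ F →
  (∀ j → P (F j) ⊎ Q (F j)) →
  ∃₂ λ As Bs → Unique As × Unique Bs × All P As × All Q Bs × length As + length Bs ≡ m
partition-image {P = P} {Q} {m} F F-inj side =
  map F lefts , map F rights ,
  UniqueP.map⁺ F-inj (UniqueP.filter⁺ left? (UniqueP.allFin⁺ m)) ,
  UniqueP.map⁺ F-inj (UniqueP.filter⁺ (∁? left?) (UniqueP.allFin⁺ m)) ,
  AllP.map⁺ (All.map (λ {j} → to-witness-T (isInj₁ (side j))) (AllP.all-filter left? (allFin m))) ,
  AllP.map⁺ (All.map (λ {j} → fromRight (side j)) (AllP.all-filter (∁? left?) (allFin m))) ,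
  sizes
  where
  left? : Decidable (λ j → T (is-just (isInj₁ (side j))))
  left? j = T? (is-just (isInj₁ (side j)))

  lefts rights : List (Fin m)
  lefts  = filter left? (allFin m)
  rights = filter (∁? left?) (allFin m)

  fromRight : ∀ {j} (s : P (F j) ⊎ Q (F j)) → ¬ T (is-just (isInj₁ s)) → Q (F j)
  fromRight (inj₁ _) ¬left = ⊥-elim (¬left tt)
  fromRight (inj₂ q) _     = q

  open ≡.≡-Reasoning

  sizes : length (map F lefts) + length (map F rights) ≡ m
  sizes = begin
    length (map F lefts) + length (map F rights) ≡⟨ ≡.cong₂ _+_ (length-map F lefts) (length-map F rights) ⟩
    length lefts + length rights                 ≡⟨ length-filter+length-filter-∁ left? (allFin m) ⟩
    length (allFin m)                            ≡⟨ length-tabulate id ⟩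
    m                                            ∎

two-components-bound : ∀ {n q m} {H : Graph n} → TwoLargestAtMost H q →
  (F : Fin m → Fin n) → Injective _≡_ _≡_ F →
  ∀ {u v} → ¬ Reach H u v → (∀ j → Reach H u (F j) ⊎ Reach H v (F j)) → m ≤ q
two-components-bound {q = q} small F F-inj u↛v side with partition-image F F-inj side
... | As , Bs , As! , Bs! , As⊆u , Bs⊆v , |As|+|Bs|≡m =
  subst (_≤ q) |As|+|Bs|≡m (small _ _ u↛v As Bs As! Bs! As⊆u Bs⊆v)

module _ {n q : ℕ} {H : Graph n} (disconnected : Disconnected H) (small : TwoLargestAtMost H q) where

  component-bound : ∀ {m} (F : Fin m → Fin n) → Injective _≡_ _≡_ F →
    ∀ u → (∀ j → Reach H u (F j)) → m < q
  component-bound {m} F F-inj u in-component =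
    decidable-stable (m <? q) (¬¬-map with-outsider (unreachable-vertex disconnected u))
    where
    with-outsider : (∃ λ w → ¬ Reach H u w) → m < q
    with-outsider (w , u↛w) =
      subst (_≤ q) (≡.trans (cong (_+ 1) (length-tabulate F)) (+-comm m 1))
        (small u w u↛w (tabulate F) (w ∷ []) (UniqueP.tabulate⁺ F-inj) ([] ∷ [])
               (AllP.tabulate⁺ in-component) (here ∷ []))

  -- Reach H u v is not decided, so the case split happens under ¬¬, which the
  -- decidable goal m ≤ q absorbs.
  covered-bound : ∀ {m} (F : Fin m → Fin n) → Injective _≡_ _≡_ F →
    ∀ u v → (∀ j → Reach H u (F j) ⊎ Reach H v (F j)) → m ≤ q
  covered-bound {m} F F-inj u v side =
    decidable-stable (m ≤? q) (¬¬-map by-cases ¬¬-excluded-middle)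
    where
    by-cases : Dec (Reach H u v) → m ≤ q
    by-cases (yes u⇝v) = <⇒≤ (component-bound F F-inj u ([ id , reach-trans H u⇝v ] ∘ side))
    by-cases (no  u↛v) = two-components-bound small F F-inj u↛v side

module _ {n q : ℕ} {G : Graph n} (τ : TreeIn G q) where

  child parent : Fin q → Fin n
  child  i = f τ (fsuc i)
  parent i = f τ (par τ i)

  tree-covered : (H : Graph n) (v : Fin n) →
    (∀ i → T (adj H (child i) (parent i)) ⊎ child i ≡ v) →
    ∀ j → Reach H (f τ fzero) (f τ j) ⊎ Reach H v (f τ j)
  tree-covered H v in-H-or-v j = covered-below (toℕ j) j ≤-refl
    where
    covered-below : ∀ k j → toℕ j ≤ k → Reach H (f τ fzero) (f τ j) ⊎ Reach H v (f τ j)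
    covered-below _       fzero    _         = inj₁ here
    covered-below (suc k) (fsuc i) (s≤s i≤k) with in-H-or-v i
    ... | inj₂ child≡v = inj₂ (subst (Reach H v) (≡.sym child≡v) here)
    ... | inj₁ e       =
      Sum.map extend extend (covered-below k (par τ i) (≤-trans (par< τ i) i≤k))
      where
      extend : ∀ {w} → Reach H w (parent i) → Reach H w (child i)
      extend r = reach-snoc H r (adj-sym H e)

  rainbow⇒single-outside-edge : ∀ {t} (H : Graph n) (c : EdgeColoring G t) (κ : Fin t) →
    (∀ u v → ¬ T (adj H u v) → col c u v ≡ κ) → Rainbow c τ →
    ∃ λ v → ∀ i → T (adj H (child i) (parent i)) ⊎ child i ≡ v
  rainbow⇒single-outside-edge H c κ outside-κ rainbow
    with any? (λ i → ¬? (T? (adj H (child i) (parent i))))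
  ... | yes (i₀ , i₀∉H) = child i₀ , λ i →
          Sum.map₂ (λ i∉H → cong child (rainbow (≡.trans (outside-κ _ _ i∉H)
                                                          (≡.sym (outside-κ _ _ i₀∉H)))))
                   (toSum (T? _))
  ... | no none = f τ fzero , λ i →
          Sum.map₂ (λ i∉H → ⊥-elim (none (i , i∉H))) (toSum (T? _))

one-outside-colour⇒noRainbowTree : ∀ {n q t} {G H : Graph n} →
  Disconnected H → TwoLargestAtMost H q → (c : EdgeColoring G t) (κ : Fin t) →
  (∀ u v → ¬ T (adj H u v) → col c u v ≡ κ) → NoRainbowTree c q
one-outside-colour⇒noRainbowTree {q = q} {H = H} disconnected small c κ outside-κ τ rainbow
  with rainbow⇒single-outside-edge τ H c κ outside-κ rainbow
... | v , in-H-or-v =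
  n≮n q (covered-bound disconnected small (f τ) (f-inj τ) (f τ fzero) v
                       (tree-covered τ H v in-H-or-v))

index-∈-lookup : ∀ {A : Set} (xs : List A) i → index (∈-lookup {xs = xs} i) ≡ i
index-∈-lookup (x ∷ xs) fzero    = refl
index-∈-lookup (x ∷ xs) (fsuc i) = cong fsuc (index-∈-lookup xs i)

module IndexOrLast {A : Set} (_≟ᴬ_ : DecidableEquality A) (xs : List A) where

  open DecMembership _≟ᴬ_ using (_∈?_)

  indexOrLast : A → Fin (suc (length xs))
  indexOrLast x with x ∈? xs
  ... | yes x∈xs = inject₁ (index x∈xs)
  ... | no  _    = fromℕ (length xs)

  indexOrLast-∉ : ∀ {x} → x ∉ xs → indexOrLast x ≡ fromℕ (length xs)
  indexOrLast-∉ {x} x∉xs with x ∈? xs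
  ... | yes x∈xs = contradiction x∈xs x∉xs
  ... | no  _    = refl

  indexOrLast-lookup : Unique xs → ∀ i → indexOrLast (lookup xs i) ≡ inject₁ i
  indexOrLast-lookup xs! i with lookup xs i ∈? xs
  ... | yes x∈xs =
    cong inject₁ (≡.trans (cong index (∈-irrelevant x∈xs (∈-lookup i))) (index-∈-lookup xs i))
    where ∈-irrelevant = unique⇒irrelevant (≡.setoid A) (Decidable⇒UIP.≡-irrelevant _≟ᴬ_) xs!
  ... | no  x∉xs = contradiction (∈-lookup i) x∉xs

module _ {n : ℕ} where

  allPairs : List (Fin n × Fin n)
  allPairs = cartesianProduct (allFin n) (allFin n)

  sortPair : Fin n → Fin n → Fin n × Fin n
  sortPair u v with toℕ u <? toℕ v
  ... | yes _ = u , v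
  ... | no  _ = v , u

  sortPair-< : ∀ {u v} → toℕ u < toℕ v → sortPair u v ≡ (u , v)
  sortPair-< {u} {v} u<v with toℕ u <? toℕ v
  ... | yes _   = refl
  ... | no  u≮v = contradiction u<v u≮v

  sortPair-comm : ∀ {u v} → u ≢ v → sortPair u v ≡ sortPair v u
  sortPair-comm {u} {v} u≢v with toℕ u <? toℕ v | toℕ v <? toℕ u
  ... | yes u<v | yes v<u = contradiction v<u (<-asym u<v)
  ... | yes _   | no  _   = refl
  ... | no  _   | yes _   = refl
  ... | no  u≮v | no  v≮u = contradiction (toℕ-injective (≤-antisym (≮⇒≥ v≮u) (≮⇒≥ u≮v))) u≢v

  sortPair-adj : (H : Graph n) → ∀ u v → let (x , y) = sortPair u v in T (adj H x y) → T (adj H u v)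
  sortPair-adj H u v with toℕ u <? toℕ v
  ... | yes _ = id
  ... | no  _ = adj-sym H

module _ {n : ℕ} (H : Graph n) where

  IsEdgeKey : Fin n × Fin n → Set
  IsEdgeKey (u , v) = toℕ u < toℕ v × T (adj H u v)

  isEdgeKey? : Decidable IsEdgeKey
  isEdgeKey? (u , v) = (toℕ u <? toℕ v) ×-dec T? (adj H u v)

  edgeList : List (Fin n × Fin n)
  edgeList = filter isEdgeKey? allPairs

  edgeList-unique : Unique edgeList
  edgeList-unique =
    UniqueP.filter⁺ isEdgeKey? (UniqueP.cartesianProduct⁺ (UniqueP.allFin⁺ n) (UniqueP.allFin⁺ n))

  open IndexOrLast (≡-dec _≟_ _≟_) edgeList

  edgeColour : Fin n → Fin n → Fin (suc (edgeCount H))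
  edgeColour u v = indexOrLast (sortPair u v)

  edgeColour-comm : ∀ {u v} → u ≢ v → edgeColour u v ≡ edgeColour v u
  edgeColour-comm u≢v = cong (indexOrLast) (sortPair-comm u≢v)

  edgeColour-outside : ∀ u v → ¬ T (adj H u v) → edgeColour u v ≡ fromℕ (edgeCount H)
  edgeColour-outside u v uv∉H = indexOrLast-∉ λ uv∈edgeList →
    uv∉H (sortPair-adj H u v (proj₂ (proj₂ (∈-filter⁻ isEdgeKey? {xs = allPairs} uv∈edgeList))))

  edgeColour-onto : ∀ k → ∃₂ λ u v → T (adj H u v) × edgeColour u v ≡ inject₁ k
  edgeColour-onto k with ∈-filter⁻ isEdgeKey? {xs = allPairs} (∈-lookup {xs = edgeList} k)
  ... | _ , u<v , e = _ , _ , e ,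
    ≡.trans (cong (indexOrLast) (sortPair-< u<v))
            (indexOrLast-lookup edgeList-unique k)

edgeColouring : ∀ {n} {G H : Graph n} → Connected G → Disconnected H → H ⊆G G →
  EdgeColoring G (suc (edgeCount H))
edgeColouring {G = G} {H} connected (a , b , a↛b) H⊆G = record
  { col  = edgeColour H
  ; symc = λ u v e → edgeColour-comm H (adj⇒≢ G e)
  ; surj = onto
  }
  where
  onto : ∀ k → ∃₂ λ u v → T (adj G u v) × edgeColour H u v ≡ k
  onto k with view k
  ... | ‵fromℕ with crossing-edge G H (connected a b) a↛b
  ...   | x , y , e , xy∉H = x , y , e , edgeColour-outside H x y xy∉H
  onto k | ‵inject₁ k′ with edgeColour-onto H k′
  ...   | u , v , e , colour≡ = u , v , H⊆G u v e , colour≡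

lemma2p1 : (n : ℕ) (G : Graph n) → Connected G → 3 ≤ n →
    (q : ℕ) → 2 ≤ q → q ≤ n ∸ 1 →
    (H : Graph n) → LAdmissible G q H →
    arAtLeast G q (suc (edgeCount H))
lemma2p1 n G connected _ q _ _ H (H⊆G , disconnected , small) =
  suc (edgeCount H) , ≤-refl , colouring ,
  one-outside-colour⇒noRainbowTree disconnected small colouring
    (fromℕ (edgeCount H)) (edgeColour-outside H)
  where
  colouring : EdgeColoring G (suc (edgeCount H))
  colouring = edgeColouring connected disconnected H⊆G
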